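{- For any path $P_n$ of order $n\geq 3$, $\gamma_{t}(M(P_n))=\left\lceil \frac{2n}{3} \right\rceil$.
   Context: All graphs are finite and simple. $P_n$ is the path on $n$ vertices. For a graph $H$ with no isolated vertices, a total dominating set of $H$ is a set $S\subseteq V(H)$ such that every vertex of $H$ has at least one neighbor in $S$; $\gamma_t(H)$ is the minimum cardinality of a total dominating set. The middle graph $M(G)$ of a graph $G$ has vertex set $V(G)\cup E(G)$ (disjoint union), and two of its vertices $x,y$ are adjacent exactly when either $x,y\in E(G)$ are edges of $G$ sharing a common endpoint, or $x\in V(G)$, $y\in E(G)$ and $x$ is an endpoint of $y$ (no two elements of $V(G)$ are adjacent in $M(G)$). -}

module Defs where

open import Data.Nat using (ℕ; zero; suc; _<_; _≤_; _≡ᵇ_)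
open import Data.Nat.Properties using (_≟_)
open import Data.Fin using (Fin; toℕ)
open import Data.Bool using (Bool; T; true; false; _∨_)
open import Data.Bool.Properties using (∨-comm)
open import Data.Sum using (_⊎_; inj₁; inj₂)
open import Data.Product using (Σ; _×_; _,_; ∃)
open import Data.List using (List; length)
open import Data.List.Membership.Propositional using (_∈_)
open import Data.List.Relation.Unary.Unique.Propositional using (Unique)
open import Relation.Binary.PropositionalEquality using (_≡_; refl; cong)
open import Relation.Nullary using (¬_; does)

record Graph (n : ℕ) : Set where
  field
    adj    : Fin n → Fin n → Bool
    sym    : ∀ i j → adj i j ≡ adj j i
    irrefl : ∀ i → adj i i ≡ false
open Graph public

record AbstractGraph : Set₁ where
  field
    Vx  : Set
    Adj : Vx → Vx → Set
open AbstractGraph public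

-- Edges of G: unordered pairs {i,j} represented by i < j with i,j adjacent.
Edge : ∀ {n} → Graph n → Set
Edge {n} G = Σ (Fin n × Fin n) λ { (i , j) → toℕ i < toℕ j × T (adj G i j) }


Incident : ∀ {n} {G : Graph n} → Fin n → Edge G → Set
Incident v ((i , j) , _) = (v ≡ i) ⊎ (v ≡ j)

ShareEnd : ∀ {n} {G : Graph n} → Edge G → Edge G → Set
ShareEnd {G = G} e f = ¬ (e ≡ f) × ∃ λ v → Incident {G = G} v e × Incident {G = G} v f

MAdj : ∀ {n} (G : Graph n) → (Fin n ⊎ Edge G) → (Fin n ⊎ Edge G) → Set
MAdj G (inj₁ v) (inj₁ w) = Data.Empty.⊥
  where import Data.Empty
MAdj G (inj₁ v) (inj₂ e) = Incident {G = G} v e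
MAdj G (inj₂ e) (inj₁ v) = Incident {G = G} v e
MAdj G (inj₂ e) (inj₂ f) = ShareEnd {G = G} e f

Middle : ∀ {n} → Graph n → AbstractGraph
Middle {n} G = record { Vx = Fin n ⊎ Edge G ; Adj = MAdj G }

pathAdj : ∀ {n} → Fin n → Fin n → Bool
pathAdj i j = (toℕ j ≡ᵇ suc (toℕ i)) ∨ (toℕ i ≡ᵇ suc (toℕ j))

private
  m≡ᵇ1+m : ∀ m → (m ≡ᵇ suc m) ≡ false
  m≡ᵇ1+m zero = refl
  m≡ᵇ1+m (suc m) = m≡ᵇ1+m m

Path : (n : ℕ) → Graph n
Path n = record { adj = pathAdj ; sym = λ i j → ∨-comm (toℕ j ≡ᵇ suc (toℕ i)) (toℕ i ≡ᵇ suc (toℕ j))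
                ; irrefl = λ i → cong (λ b → b ∨ b) (m≡ᵇ1+m (toℕ i)) }

record VSet (H : AbstractGraph) : Set where
  field
    elems  : List (Vx H)
    unique : Unique elems
open VSet public

∣_∣ : ∀ {H} → VSet H → ℕ
∣ S ∣ = length (elems S)

IsTDS : (H : AbstractGraph) → VSet H → Set
IsTDS H S = ∀ (x : Vx H) → ∃ λ y → (y ∈ elems S) × Adj H x y

γt≡ : AbstractGraph → ℕ → Set
γt≡ H k = (Σ (VSet H) λ S → IsTDS H S × ∣ S ∣ ≡ k)
        × (∀ (S : VSet H) → IsTDS H S → k ≤ ∣ S ∣)

-- Place M(P_n) on a line, the vertex p at 2p+1 and the edge {a, a+1} at 2a+2; adjacent
-- elements are then at distance 1 or 2. Upper bound: the edges starting at n-2 and n-3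
-- totally dominate the last three vertices of P_n and the edges among them, so recursing on
-- n-3 gives a total dominating set of ⌈2n/3⌉ edges. Lower bound: a total dominating set S
-- has two members with positions in every window [2j, 2j+6), j+2 ≤ n: the dominator x of
-- the vertex j+1 sits at 2j+2 or 2j+4, and the dominator of x, respectively of the vertex j,
-- is a second one. The windows for j = n-2, n-5, … are disjoint, and the remainder of n
-- modulo 3 costs one more window at 0 or the dominator of the vertex 0.
module Submission where

open import Defs hiding (sym)
open import Data.Nat using (ℕ; zero; suc; _≤_; _<_; _>_; _+_; _*_; _/_; _≡ᵇ_; z≤n; s≤s; z<s)
open import Data.Nat.Properties
open import Data.Nat.DivMod using (m/n≡1+[m∸n]/n)
open import Data.Fin using (Fin; toℕ; fromℕ<)
open import Data.Fin.Properties using (toℕ-injective; toℕ<n; toℕ-fromℕ<)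
open import Data.Bool using (T; _∨_)
open import Data.Bool.Properties using (T-∨; T-irrelevant)
open import Data.List using (List; []; _∷_; length; map)
open import Data.List.Properties using (length-map)
open import Data.List.Membership.Propositional using (_∈_; mapWith∈)
open import Data.List.Membership.Propositional.Properties using (∈-map⁺; map-mapWith∈; mapWith∈-cong; mapWith∈-id)
open import Data.List.Relation.Binary.Subset.Propositional using (_⊆_)
open import Data.List.Relation.Unary.All as All using (All; []; _∷_)
open import Data.List.Relation.Unary.AllPairs as AllPairs using (AllPairs; []; _∷_)
open import Data.List.Relation.Unary.Any using (here; there)
open import Data.List.Relation.Unary.Any.Properties using (mapWith∈⁺)
open import Data.List.Relation.Unary.Unique.Propositional using (Unique)
import Data.List.Relation.Unary.Unique.Propositional.Properties as Unique
open import Data.Product using (∃; _×_; _,_; proj₁; proj₂)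
open import Data.Sum as Sum using (_⊎_; inj₁; inj₂)
open import Data.Sum.Properties using (inj₂-injective)
open import Data.Empty using (⊥-elim)
open import Function.Base using (_∘_)
open import Function.Bundles using (Equivalence)
open import Relation.Binary.PropositionalEquality
open import Relation.Binary.Definitions using (tri<; tri≈; tri>)
open import Level using (Level)

private
  variable
    ℓ : Level
    A : Set ℓ
    x : A
    xs ys : List A
    n : ℕ

∈-remove : x ∈ ys → ∃ λ zs → length ys ≡ suc (length zs) × (∀ {y} → y ∈ ys → y ≢ x → y ∈ zs)
∈-remove {ys = y ∷ ys} (here refl) = ys , refl , keep
  where
  keep : ∀ {z} → z ∈ y ∷ ys → z ≢ y → z ∈ ys
  keep (here refl) z≢y = ⊥-elim (z≢y refl)
  keep (there z∈ys) _ = z∈ys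
∈-remove {ys = y ∷ ys} (there x∈ys) with ∈-remove x∈ys
... | zs , len , keep = y ∷ zs , cong suc len , keep′
  where
  keep′ : ∀ {z} → z ∈ y ∷ ys → z ≢ _ → z ∈ y ∷ zs
  keep′ (here refl) _ = here refl
  keep′ (there z∈ys) z≢x = there (keep z∈ys z≢x)

unique⊆⇒length≤ : Unique xs → xs ⊆ ys → length xs ≤ length ys
unique⊆⇒length≤ [] _ = z≤n
unique⊆⇒length≤ (x≢xs ∷ unique) xs⊆ys with ∈-remove (xs⊆ys (here refl))
... | zs , len , keep = subst (_ ≤_) (sym len)
  (s≤s (unique⊆⇒length≤ unique λ y∈xs → keep (xs⊆ys (there y∈xs)) (≢-sym (All.lookup x≢xs y∈xs))))

-- The starts a of the edges {a, a+1} of a minimum total dominating set of M(P_n). For n ≤ 2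
-- they need not be edges of P_n: these cases only seed the recursion.
tdsStarts : ℕ → List ℕ
tdsStarts 0 = []
tdsStarts 1 = 0 ∷ []
tdsStarts 2 = 1 ∷ 0 ∷ []
tdsStarts (suc (suc (suc n))) = suc n ∷ n ∷ tdsStarts n

[3+m]/3≡1+m/3 : ∀ m → (3 + m) / 3 ≡ suc (m / 3)
[3+m]/3≡1+m/3 m = m/n≡1+[m∸n]/n (m≤m+n 3 m)

length-tdsStarts : ∀ n → length (tdsStarts n) ≡ (2 * n + 2) / 3
length-tdsStarts 0 = refl
length-tdsStarts 1 = refl
length-tdsStarts 2 = refl
length-tdsStarts (suc (suc (suc n))) = begin
  2 + length (tdsStarts n)         ≡⟨ cong (2 +_) (length-tdsStarts n) ⟩
  2 + (2 * n + 2) / 3              ≡⟨ sym (cong suc ([3+m]/3≡1+m/3 (2 * n + 2))) ⟩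
  1 + (3 + (2 * n + 2)) / 3        ≡⟨ sym ([3+m]/3≡1+m/3 (3 + (2 * n + 2))) ⟩
  (6 + (2 * n + 2)) / 3            ≡⟨ cong (λ k → (k + 2) / 3) (sym (*-distribˡ-+ 2 3 n)) ⟩
  (2 * (3 + n) + 2) / 3            ∎
  where open ≡-Reasoning

tdsStarts-< : ∀ n → All (_< n) (tdsStarts n)
tdsStarts-< 0 = []
tdsStarts-< 1 = z<s ∷ []
tdsStarts-< 2 = n<1+n 1 ∷ m<n⇒m<1+n z<s ∷ []
tdsStarts-< (suc (suc (suc n))) =
  m<n⇒m<1+n (n<1+n (suc n)) ∷ m<n⇒m<1+n (m<n⇒m<1+n (n<1+n n))
  ∷ All.map (λ a<n → m<n⇒m<1+n (m<n⇒m<1+n (m<n⇒m<1+n a<n))) (tdsStarts-< n)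

tdsStarts-decreasing : ∀ n → AllPairs _>_ (tdsStarts n)
tdsStarts-decreasing 0 = []
tdsStarts-decreasing 1 = [] ∷ []
tdsStarts-decreasing 2 = (z<s ∷ []) ∷ [] ∷ []
tdsStarts-decreasing (suc (suc (suc n))) =
  (n<1+n n ∷ All.map m<n⇒m<1+n (tdsStarts-< n)) ∷ tdsStarts-< n ∷ tdsStarts-decreasing n

tdsStarts-valid : 3 ≤ n → All (λ a → suc a < n) (tdsStarts n)
tdsStarts-valid {1} (s≤s ())
tdsStarts-valid {2} (s≤s (s≤s ()))
tdsStarts-valid {suc (suc (suc n))} _ =
  ≤-refl ∷ m<n⇒m<1+n ≤-refl
  ∷ All.map (λ a<n → m<n⇒m<1+n (m<n⇒m<1+n (s≤s a<n))) (tdsStarts-< n)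

<3+-cases : ∀ {p} n → p < 3 + n → p < n ⊎ p ≡ n ⊎ p ≡ suc n ⊎ p ≡ suc (suc n)
<3+-cases {0} zero _ = inj₂ (inj₁ refl)
<3+-cases {1} zero _ = inj₂ (inj₂ (inj₁ refl))
<3+-cases {2} zero _ = inj₂ (inj₂ (inj₂ refl))
<3+-cases {suc (suc (suc p))} zero (s≤s (s≤s (s≤s ())))
<3+-cases {zero} (suc n) _ = inj₁ z<s
<3+-cases {suc p} (suc n) (s≤s p<3+n) =
  Sum.map s≤s (Sum.map (cong suc) (Sum.map (cong suc) (cong suc))) (<3+-cases n p<3+n)

record Dominating (n : ℕ) (D : List ℕ) : Set where
  field
    covers-vertices : ∀ p → p < n → ∃ λ a → a ∈ D × (p ≡ a ⊎ p ≡ suc a)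
    covers-edges    : ∀ a → suc a < n → ∃ λ b → b ∈ D × (a ≡ suc b ⊎ b ≡ suc a)

tdsStarts-dominating : ∀ n → Dominating n (tdsStarts n)
tdsStarts-dominating 0 = record { covers-vertices = λ _ () ; covers-edges = λ _ () }
tdsStarts-dominating 1 = record
  { covers-vertices = λ { 0 _ → 0 , here refl , inj₁ refl
                        ; (suc _) (s≤s ()) }
  ; covers-edges    = λ _ → λ { (s≤s ()) }
  }
tdsStarts-dominating 2 = record
  { covers-vertices = λ { 0 _ → 0 , there (here refl) , inj₁ refl
                        ; 1 _ → 1 , here refl , inj₁ refl
                        ; (suc (suc _)) (s≤s (s≤s ())) }
  ; covers-edges    = λ { 0 _ → 1 , here refl , inj₂ refl
                        ; (suc _) (s≤s (s≤s ())) }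
  }
tdsStarts-dominating (suc (suc (suc n))) = record
  { covers-vertices = covers-vertices
  ; covers-edges    = covers-edges
  }
  where
  open Dominating (tdsStarts-dominating n) renaming (covers-vertices to old-vertices; covers-edges to old-edges)
  covers-vertices : ∀ p → p < 3 + n → ∃ λ a → a ∈ tdsStarts (3 + n) × (p ≡ a ⊎ p ≡ suc a)
  covers-vertices p p<3+n with <3+-cases n p<3+n
  ... | inj₁ p<n with old-vertices p p<n
  ...   | a , a∈ , p~a = a , there (there a∈) , p~a
  covers-vertices p _ | inj₂ (inj₁ refl)        = p , there (here refl) , inj₁ refl
  covers-vertices p _ | inj₂ (inj₂ (inj₁ refl)) = n , there (here refl) , inj₂ refl
  covers-vertices p _ | inj₂ (inj₂ (inj₂ refl)) = suc n , here refl , inj₂ refl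
  covers-edges : ∀ a → suc a < 3 + n → ∃ λ b → b ∈ tdsStarts (3 + n) × (a ≡ suc b ⊎ b ≡ suc a)
  covers-edges a 1+a<3+n with <3+-cases n 1+a<3+n
  ... | inj₁ 1+a<n with old-edges a 1+a<n
  ...   | b , b∈ , a~b = b , there (there b∈) , a~b
  covers-edges a _ | inj₂ (inj₁ refl)        = suc a , there (here refl) , inj₂ refl
  covers-edges a _ | inj₂ (inj₂ (inj₁ refl)) = suc a , here refl , inj₂ refl
  covers-edges a _ | inj₂ (inj₂ (inj₂ refl)) = n , there (here refl) , inj₁ refl

PathEdge : ℕ → Set
PathEdge n = Edge (Path n)

left right : PathEdge n → Fin n
left ((i , _) , _) = i
right ((_ , j) , _) = j

start : PathEdge n → ℕ
start e = toℕ (left e)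

toℕ-right : (e : PathEdge n) → toℕ (right e) ≡ suc (start e)
toℕ-right ((i , j) , i<j , i~j) with Equivalence.to T-∨ i~j
... | inj₁ j≡1+i = ≡ᵇ⇒≡ _ _ j≡1+i
... | inj₂ i≡1+j = ⊥-elim (<-asym i<j (≤-reflexive (sym (≡ᵇ⇒≡ _ _ i≡1+j))))

start-injective : (e f : PathEdge n) → start e ≡ start f → e ≡ f
start-injective e@((i , j) , i<j , i~j) f@((i′ , j′) , i′<j′ , i′~j′) eq
  with toℕ-injective eq | toℕ-injective (trans (toℕ-right e) (trans (cong suc eq) (sym (toℕ-right f))))
... | refl | refl = cong₂ (λ lt adj → (i , j) , lt , adj) (<-irrelevant i<j i′<j′) (T-irrelevant i~j i′~j′)

edge : (a : ℕ) → suc a < n → PathEdge n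
edge {n} a 1+a<n = (fromℕ< a<n , fromℕ< 1+a<n) , ordered , adjacent
  where
  a<n : a < n
  a<n = <-trans (n<1+n a) 1+a<n
  ordered : toℕ (fromℕ< a<n) < toℕ (fromℕ< 1+a<n)
  ordered rewrite toℕ-fromℕ< a<n | toℕ-fromℕ< 1+a<n = n<1+n a
  adjacent : T ((toℕ (fromℕ< 1+a<n) ≡ᵇ suc (toℕ (fromℕ< a<n))) ∨ (toℕ (fromℕ< a<n) ≡ᵇ suc (toℕ (fromℕ< 1+a<n))))
  adjacent rewrite toℕ-fromℕ< a<n | toℕ-fromℕ< 1+a<n = Equivalence.from T-∨ (inj₁ (≡⇒≡ᵇ (suc a) (suc a) refl))

start-edge : (a : ℕ) (1+a<n : suc a < n) → start (edge a 1+a<n) ≡ a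
start-edge a 1+a<n = toℕ-fromℕ< _

module _ {v : Fin n} {e : PathEdge n} where

  incident⁻ : MAdj (Path n) (inj₁ v) (inj₂ e) → toℕ v ≡ start e ⊎ toℕ v ≡ suc (start e)
  incident⁻ (inj₁ refl) = inj₁ refl
  incident⁻ (inj₂ refl) = inj₂ (toℕ-right e)

  incident⁺ : toℕ v ≡ start e ⊎ toℕ v ≡ suc (start e) → MAdj (Path n) (inj₁ v) (inj₂ e)
  incident⁺ (inj₁ v≡s) = inj₁ (toℕ-injective v≡s)
  incident⁺ (inj₂ v≡1+s) = inj₂ (toℕ-injective (trans v≡1+s (sym (toℕ-right e))))

module _ {e f : PathEdge n} where

  consecutive⁻ : MAdj (Path n) (inj₂ e) (inj₂ f) → start e ≡ suc (start f) ⊎ start f ≡ suc (start e)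
  consecutive⁻ (e≢f , v , v∈e , v∈f) with incident⁻ {e = e} v∈e | incident⁻ {e = f} v∈f
  ... | inj₁ v≡e   | inj₁ v≡f   = ⊥-elim (e≢f (start-injective e f (trans (sym v≡e) v≡f)))
  ... | inj₁ v≡e   | inj₂ v≡1+f = inj₁ (trans (sym v≡e) v≡1+f)
  ... | inj₂ v≡1+e | inj₁ v≡f   = inj₂ (trans (sym v≡f) v≡1+e)
  ... | inj₂ v≡1+e | inj₂ v≡1+f = ⊥-elim (e≢f (start-injective e f (suc-injective (trans (sym v≡1+e) v≡1+f))))

  consecutive⁺ : start e ≡ suc (start f) ⊎ start f ≡ suc (start e) → MAdj (Path n) (inj₂ e) (inj₂ f)
  consecutive⁺ (inj₁ e≡1+f) =
    (λ { refl → 1+n≢n (sym e≡1+f) }) , left e , inj₁ refl , incident⁺ {e = f} (inj₂ e≡1+f)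
  consecutive⁺ (inj₂ f≡1+e) =
    (λ { refl → 1+n≢n (sym f≡1+e) }) , right e , inj₂ refl , incident⁺ {e = f} (inj₁ (trans (toℕ-right e) (sym f≡1+e)))

module _ {D : List ℕ} (dominating : Dominating n D) (valid : All (λ a → suc a < n) D) (distinct : Unique D) where
  open Dominating dominating

  edgeOf : ∀ {a} → a ∈ D → PathEdge n
  edgeOf {a} a∈D = edge a (All.lookup valid a∈D)

  start-edgeOf : ∀ {a} (a∈D : a ∈ D) → start (edgeOf a∈D) ≡ a
  start-edgeOf {a} a∈D = start-edge a (All.lookup valid a∈D)

  edgesAt : List (PathEdge n)
  edgesAt = mapWith∈ D edgeOf

  edgeOf∈edgesAt : ∀ {a} (a∈D : a ∈ D) → edgeOf a∈D ∈ edgesAt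
  edgeOf∈edgesAt a∈D = mapWith∈⁺ edgeOf (_ , a∈D , refl)

  map-start-edgesAt : map start edgesAt ≡ D
  map-start-edgesAt = begin
    map start edgesAt                  ≡⟨ map-mapWith∈ D edgeOf start ⟩
    mapWith∈ D (λ a∈D → start (edgeOf a∈D)) ≡⟨ mapWith∈-cong D _ _ start-edgeOf ⟩
    mapWith∈ D (λ {a} _ → a)           ≡⟨ mapWith∈-id D ⟩
    D                                  ∎
    where open ≡-Reasoning

  edgeSet : VSet (Middle (Path n))
  edgeSet = record
    { elems  = map inj₂ edgesAt
    ; unique = Unique.map⁺ inj₂-injective (Unique.map⁻ (subst Unique (sym map-start-edgesAt) distinct))
    }

  ∣edgeSet∣ : ∣ edgeSet ∣ ≡ length D
  ∣edgeSet∣ = begin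
    length (map inj₂ edgesAt)   ≡⟨ length-map inj₂ edgesAt ⟩
    length edgesAt              ≡⟨ length-map start edgesAt ⟨
    length (map start edgesAt)  ≡⟨ cong length map-start-edgesAt ⟩
    length D                    ∎
    where open ≡-Reasoning

  edgeSet-isTDS : IsTDS (Middle (Path n)) edgeSet
  edgeSet-isTDS (inj₁ v) with covers-vertices (toℕ v) (toℕ<n v)
  ... | a , a∈D , v~a = inj₂ (edgeOf a∈D) , ∈-map⁺ inj₂ (edgeOf∈edgesAt a∈D) , incident⁺ {e = edgeOf a∈D} v~edge
    where
    v~edge : toℕ v ≡ start (edgeOf a∈D) ⊎ toℕ v ≡ suc (start (edgeOf a∈D))
    v~edge rewrite start-edgeOf a∈D = v~a
  edgeSet-isTDS (inj₂ e) with covers-edges (start e) (subst (_< n) (toℕ-right e) (toℕ<n (right e)))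
  ... | b , b∈D , e~b = inj₂ (edgeOf b∈D) , ∈-map⁺ inj₂ (edgeOf∈edgesAt b∈D) , consecutive⁺ e~edge
    where
    e~edge : start e ≡ suc (start (edgeOf b∈D)) ⊎ start (edgeOf b∈D) ≡ suc (start e)
    e~edge rewrite start-edgeOf b∈D = e~b

-- M(P_n) laid out on a line: v_p sits at 2p+1 and the edge {a, a+1} at 2a+2, so that v₀ e₀ v₁ e₁ … occur in order.
pos : Fin n ⊎ PathEdge n → ℕ
pos (inj₁ v) = suc (toℕ v * 2)
pos (inj₂ e) = suc (start e) * 2

Close : ℕ → ℕ → Set
Close a b = a ≢ b × a ≤ 2 + b × b ≤ 2 + a

close-sym : ∀ {a b} → Close a b → Close b a
close-sym (a≢b , a≤2+b , b≤2+a) = ≢-sym a≢b , b≤2+a , a≤2+b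

close-suc : ∀ a → Close a (suc a)
close-suc a = <⇒≢ (n<1+n a) , m≤n+m a 3 , n≤1+n (suc a)

close-2+ : ∀ a → Close a (2 + a)
close-2+ a = <⇒≢ (m<n⇒m<1+n (n<1+n a)) , m≤n+m a 4 , ≤-refl

Flanks : ℕ → ℕ → Set
Flanks k b = b ≡ k * 2 ⊎ b ≡ suc k * 2

flanks⇒bounds : ∀ k {b} → Flanks k b → k * 2 ≤ b × b ≤ suc k * 2
flanks⇒bounds k (inj₁ refl) = ≤-refl , m≤n+m (k * 2) 2
flanks⇒bounds k (inj₂ refl) = m≤n+m (k * 2) 2 , ≤-refl

flanks⇒close : ∀ k {b} → Flanks k b → Close (suc (k * 2)) b
flanks⇒close k (inj₁ refl) = close-sym (close-suc (k * 2))
flanks⇒close k (inj₂ refl) = close-suc (suc (k * 2))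

vertex-neighbour-flanks : ∀ {v : Fin n} y → MAdj (Path n) (inj₁ v) y → Flanks (toℕ v) (pos y)
vertex-neighbour-flanks (inj₂ e) v~e with incident⁻ {e = e} v~e
... | inj₁ v≡s   = inj₂ (cong (λ k → suc k * 2) (sym v≡s))
... | inj₂ v≡1+s = inj₁ (cong (_* 2) (sym v≡1+s))

adjacent⇒close : ∀ x y → MAdj (Path n) x y → Close (pos x) (pos y)
adjacent⇒close (inj₁ v) y v~y = flanks⇒close (toℕ v) (vertex-neighbour-flanks y v~y)
adjacent⇒close (inj₂ e) (inj₁ v) e~v = close-sym (flanks⇒close (toℕ v) (vertex-neighbour-flanks (inj₂ e) e~v))
adjacent⇒close (inj₂ e) (inj₂ f) e~f with consecutive⁻ e~f
... | inj₁ e≡1+f = subst (λ s → Close (suc s * 2) (pos (inj₂ f))) (sym e≡1+f) (close-sym (close-2+ _))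
... | inj₂ f≡1+e = subst (λ s → Close (pos (inj₂ e)) (suc s * 2)) (sym f≡1+e) (close-2+ _)

module LowerBound (S : VSet (Middle (Path n))) (isTDS : IsTDS (Middle (Path n)) S) where

  vertexDominator : ∀ {p} → p < n → ∃ λ y → y ∈ elems S × Flanks p (pos y)
  vertexDominator p<n with isTDS (inj₁ (fromℕ< p<n))
  ... | y , y∈S , v~y = y , y∈S , subst (λ k → Flanks k (pos y)) (toℕ-fromℕ< p<n) (vertex-neighbour-flanks y v~y)

  closeDominator : ∀ x → ∃ λ y → y ∈ elems S × Close (pos x) (pos y)
  closeDominator x with isTDS x
  ... | y , y∈S , x~y = y , y∈S , adjacent⇒close x y x~y

  record Window (lo : ℕ) : Set where
    field
      lower upper : Fin n ⊎ PathEdge n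
      lower∈S     : lower ∈ elems S
      upper∈S     : upper ∈ elems S
      lo≤lower    : lo ≤ pos lower
      lower<upper : pos lower < pos upper
      upper<lo+6  : pos upper < 6 + lo

  windowOf : ∀ {lo} x y → x ∈ elems S → y ∈ elems S → pos x ≢ pos y →
             lo ≤ pos x → lo ≤ pos y → pos x < 6 + lo → pos y < 6 + lo → Window lo
  windowOf x y x∈S y∈S x≢y lo≤x lo≤y x<lo+6 y<lo+6 with <-cmp (pos x) (pos y)
  ... | tri< x<y _ _ = record { lower = x ; upper = y ; lower∈S = x∈S ; upper∈S = y∈S
                              ; lo≤lower = lo≤x ; lower<upper = x<y ; upper<lo+6 = y<lo+6 }
  ... | tri≈ _ x≡y _ = ⊥-elim (x≢y x≡y)
  ... | tri> _ _ y<x = record { lower = y ; upper = x ; lower∈S = y∈S ; upper∈S = x∈S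
                              ; lo≤lower = lo≤y ; lower<upper = y<x ; upper<lo+6 = x<lo+6 }

  window : ∀ j → 2 + j ≤ n → Window (j * 2)
  window j 2+j≤n with vertexDominator {suc j} 2+j≤n
  ... | x , x∈S , inj₂ x≡4+2j with vertexDominator {j} (≤-trans (n≤1+n (suc j)) 2+j≤n)
  ...   | y , y∈S , y-flanks = record
    { lower = y ; upper = x ; lower∈S = y∈S ; upper∈S = x∈S
    ; lo≤lower    = 2j≤y
    ; lower<upper = ≤-trans (s≤s y≤2+2j) (≤-trans (n≤1+n _) (≤-reflexive (sym x≡4+2j)))
    ; upper<lo+6  = subst (_< 6 + j * 2) (sym x≡4+2j) (m<n⇒m<1+n (n<1+n _))
    }
    where
    2j≤y : j * 2 ≤ pos y
    2j≤y = proj₁ (flanks⇒bounds j y-flanks)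
    y≤2+2j : pos y ≤ 2 + j * 2
    y≤2+2j = proj₂ (flanks⇒bounds j y-flanks)
  window j 2+j≤n | x , x∈S , inj₁ x≡2+2j with closeDominator x
  ... | y , y∈S , x≢y , x≤2+y , y≤2+x =
    windowOf x y x∈S y∈S x≢y
      (subst (j * 2 ≤_) (sym x≡2+2j) (m≤n+m (j * 2) 2))
      (+-cancelˡ-≤ 2 _ _ (subst (_≤ 2 + pos y) x≡2+2j x≤2+y))
      (subst (_< 6 + j * 2) (sym x≡2+2j) (m≤n+m _ 3))
      (≤-<-trans y≤2+x (subst (λ k → 2 + k < 6 + j * 2) (sym x≡2+2j) (m≤n+m _ 1)))

  record Spread (m : ℕ) : Set where
    field
      members        : List (Fin n ⊎ PathEdge n)
      length-members : length members ≡ length (tdsStarts m)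
      members⊆S      : All (_∈ elems S) members
      decreasing     : AllPairs (λ x y → pos y < pos x) members
      bounded        : All (λ x → pos x < suc m * 2) members

  spread : ∀ m → m ≤ n → Spread m
  spread 0 _ = record { members = [] ; length-members = refl ; members⊆S = [] ; decreasing = [] ; bounded = [] }
  spread 1 1≤n with vertexDominator {0} 1≤n
  ... | x , x∈S , x-flanks = record
    { members = x ∷ [] ; length-members = refl ; members⊆S = x∈S ∷ [] ; decreasing = [] ∷ []
    ; bounded = s≤s (≤-trans (proj₂ (flanks⇒bounds 0 x-flanks)) (n≤1+n 2)) ∷ []
    }
  spread 2 2≤n = record
    { members = upper ∷ lower ∷ [] ; length-members = refl
    ; members⊆S = upper∈S ∷ lower∈S ∷ []
    ; decreasing = (lower<upper ∷ []) ∷ [] ∷ []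
    ; bounded = upper<lo+6 ∷ <-trans lower<upper upper<lo+6 ∷ []
    }
    where open Window (window 0 2≤n)
  spread (suc (suc (suc m))) 3+m≤n = record
    { members        = upper ∷ lower ∷ members
    ; length-members = cong (λ k → 2 + k) length-members
    ; members⊆S      = upper∈S ∷ lower∈S ∷ members⊆S
    ; decreasing     = (lower<upper ∷ All.map (λ z<lo → <-trans (<-≤-trans z<lo lo≤lower) lower<upper) bounded)
                     ∷ All.map (λ z<lo → <-≤-trans z<lo lo≤lower) bounded
                     ∷ decreasing
    ; bounded        = upper<lo+6 ∷ <-trans lower<upper upper<lo+6
                     ∷ All.map (λ z<lo → ≤-trans z<lo (m≤n+m _ 6)) bounded
    }
    where
    open Window (window (suc m) 3+m≤n)
    open Spread (spread m (≤-trans (m≤n+m m 3) 3+m≤n))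

  lowerBound : length (tdsStarts n) ≤ ∣ S ∣
  lowerBound = subst (_≤ ∣ S ∣) length-members
    (unique⊆⇒length≤ (AllPairs.map (λ y<x → >⇒≢ y<x ∘ cong pos) decreasing) (All.lookup members⊆S))
    where open Spread (spread n ≤-refl)

proposition2p6 : ∀ (n : ℕ) → 3 ≤ n → γt≡ (Middle (Path n)) ((2 * n + 2) / 3)
proposition2p6 n 3≤n =
  (edgeSet dominating valid distinct , edgeSet-isTDS dominating valid distinct
  , trans (∣edgeSet∣ dominating valid distinct) (length-tdsStarts n))
  , λ S isTDS → subst (_≤ ∣ S ∣) (length-tdsStarts n) (LowerBound.lowerBound S isTDS)
  where
  dominating : Dominating n (tdsStarts n)
  dominating = tdsStarts-dominating n
  valid : All (λ a → suc a < n) (tdsStarts n)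
  valid = tdsStarts-valid 3≤n
  distinct : Unique (tdsStarts n)
  distinct = AllPairs.map >⇒≢ (tdsStarts-decreasing n)
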